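{- Let $G$ be drawn from the graph model. The marked nodes of $G$ are precisely the nodes of degree $2$ in $G$ whose two neighbours are both good, together with some isolated nodes of $G$.
   Context: Graph model with constants $a>b>0$, $\varepsilon=\frac{b}{a+b}$, $\delta=1$ if $\varepsilon\le\frac13$ and $\delta=(1-2\varepsilon)^2/\varepsilon^2$ otherwise: spins $\sigma_v\in\{\pm1\}$ i.i.d.\ uniform on $n$ vertices; precursor $G_{\mathrm{pre}}$ has each pair as an edge independently with probability $a/n$ (equal spins) or $b/n$ (opposite spins). The adversary: mark $v$ "good" if at least 3 neighbours of $v$ in $G_{\mathrm{pre}}$ have degree $\ne2$; mark a vertex of degree 2 in $G_{\mathrm{pre}}$ "marked" if both its neighbours are good; for each marked $v$ whose two neighbours both have spin opposite to $v$, independently with probability $\delta$ delete both edges incident to $v$. The result is $G$; the markings good/marked of $G$ are those assigned in $G_{\mathrm{pre}}$. -}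

module Defs where

open import Data.Nat using (ℕ; _+_; _≤_; _≡ᵇ_; _≤ᵇ_)
open import Data.Fin using (Fin)
open import Data.Bool using (Bool; true; false; _∧_; _xor_; not; if_then_else_; T)
open import Data.List using (List; map; allFin)
open import Data.Nat.ListAction using (sum)
open import Data.Bool.ListAction using (all)
open import Relation.Binary.PropositionalEquality using (_≡_)

record Graph (n : ℕ) : Set where
  field
    adj    : Fin n → Fin n → Bool
    sym    : ∀ u v → adj u v ≡ adj v u
    irrefl : ∀ v → adj v v ≡ false
open Graph public

count : ∀ {n} → (Fin n → Bool) → ℕ
count {n} p = sum (map (λ u → if p u then 1 else 0) (allFin n))

deg : ∀ {n} → Graph n → Fin n → ℕ
deg G v = count (adj G v)

nbrsDegNot2 : ∀ {n} → Graph n → Fin n → ℕ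
nbrsDegNot2 G v = count (λ u → adj G v u ∧ not (deg G u ≡ᵇ 2))

isGood : ∀ {n} → Graph n → Fin n → Bool
isGood G v = 3 ≤ᵇ nbrsDegNot2 G v

Good : ∀ {n} → Graph n → Fin n → Set
Good G v = 3 ≤ nbrsDegNot2 G v

allNbrs : ∀ {n} → Graph n → Fin n → (Fin n → Bool) → Bool
allNbrs {n} G v p = all (λ u → if adj G v u then p u else true) (allFin n)

isMarked : ∀ {n} → Graph n → Fin n → Bool
isMarked G v = (deg G v ≡ᵇ 2) ∧ allNbrs G v (isGood G)

Marked : ∀ {n} → Graph n → Fin n → Set
Marked G v = T (isMarked G v)

-- spin: true = +1, false = -1.  coin v = outcome of the independent
-- probability-δ deletion coin at v.
-- v is deleted iff it is marked, both neighbours have spin opposite to v,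
-- and its coin succeeds.
deleted : ∀ {n} → Graph n → (Fin n → Bool) → (Fin n → Bool) → Fin n → Bool
deleted G σ coin v =
  isMarked G v ∧ allNbrs G v (λ u → σ u xor σ v) ∧ coin v

-- The graph G: delete both edges at every deleted vertex.
resultAdj : ∀ {n} → Graph n → (Fin n → Bool) → (Fin n → Bool) → Fin n → Fin n → Bool
resultAdj G σ coin u v = adj G u v ∧ not (deleted G σ coin u) ∧ not (deleted G σ coin v)

result : ∀ {n} → Graph n → (Fin n → Bool) → (Fin n → Bool) → Graph n
result G σ coin = record
  { adj = resultAdj G σ coin
  ; sym = λ u v → symR u v
  ; irrefl = λ v → irrR v }
  where
  open import Data.Bool.Properties using (∧-comm)
  symR : ∀ u v → resultAdj G σ coin u v ≡ resultAdj G σ coin v u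
  symR u v rewrite sym G u v | ∧-comm (not (deleted G σ coin u)) (not (deleted G σ coin v)) = Relation.Binary.PropositionalEquality.refl
  irrR : ∀ v → resultAdj G σ coin v v ≡ false
  irrR v rewrite irrefl G v = Relation.Binary.PropositionalEquality.refl

-- A good vertex has at least 3 neighbours of degree ≠ 2, so its own degree is not 2: it
-- is never marked and never deleted. Deletion therefore only hits marked vertices, whose
-- neighbours are good. If v has degree 2 in G, v itself was not deleted, and neither was
-- any Gpre-neighbour u of v: u would be marked, making v good, and then v would keep its
-- ≥ 3 neighbours of degree ≠ 2 in G. So v has the same neighbourhood in G as in Gpre.
-- Conversely a marked v is either deleted, hence isolated, or keeps its neighbourhood,
-- whose vertices are good and thus undeleted.
module Submission where

open import Defs hiding (sym)
open import Data.Nat using (ℕ; _≤_; _<_; _≡ᵇ_; z≤n; s≤s)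
open import Data.Nat.Properties using (≤-trans; ≤-reflexive; m≤n⇒m≤1+n; <-irrefl; ≡ᵇ⇒≡; ≡⇒≡ᵇ; ≤ᵇ⇒≤; ≤⇒≤ᵇ)
open import Data.Nat.ListAction using (sum)
open import Data.Fin using (Fin)
open import Data.Bool using (Bool; true; false; _∧_; not; if_then_else_; T; _≟_)
open import Data.Bool.Properties using (T-≡; T-not-≡; T-∧; ¬-not; ∧-conicalˡ; ∧-conicalʳ; ∧-zeroʳ; ∧-identityʳ)
open import Data.List using (List; []; _∷_; map; allFin)
open import Data.List.Properties using (map-cong)
open import Data.List.Relation.Unary.All as All using (All)
open import Data.List.Relation.Unary.All.Properties using (all⁺; all⁻)
open import Data.List.Membership.Propositional.Properties using (∈-allFin)
open import Data.Product using (_×_; _,_; proj₁; proj₂)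
open import Data.Sum using (_⊎_; inj₁; inj₂)
open import Function using (Equivalence)
open import Relation.Nullary using (yes; no; contradiction)
open import Relation.Binary.PropositionalEquality using (_≡_; _≢_; refl; sym; trans; cong; cong₂; subst)

open Equivalence using (to; from)

countIn : ∀ {a} {A : Set a} → (A → Bool) → List A → ℕ
countIn p xs = sum (map (λ x → if p x then 1 else 0) xs)

module _ {a} {A : Set a} {p q : A → Bool} where

  countIn-cong : (∀ x → p x ≡ q x) → ∀ xs → countIn p xs ≡ countIn q xs
  countIn-cong p≗q xs = cong sum (map-cong (λ x → cong (λ b → if b then 1 else 0) (p≗q x)) xs)

  countIn-mono : (∀ x → p x ≡ true → q x ≡ true) → ∀ xs → countIn p xs ≤ countIn q xs
  countIn-mono p⇒q [] = z≤n
  countIn-mono p⇒q (x ∷ xs) with p x in px | q x in qx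
  ... | true  | true  = s≤s (countIn-mono p⇒q xs)
  ... | true  | false = contradiction (trans (sym (p⇒q x px)) qx) λ ()
  ... | false | true  = m≤n⇒m≤1+n (countIn-mono p⇒q xs)
  ... | false | false = countIn-mono p⇒q xs

countIn-zero : ∀ {a} {A : Set a} {p : A → Bool} → (∀ x → p x ≡ false) → ∀ xs → countIn p xs ≡ 0
countIn-zero p≗false []       = refl
countIn-zero p≗false (x ∷ xs) rewrite p≗false x = countIn-zero p≗false xs

∧-implied : ∀ {b c} → (b ≡ true → c ≡ true) → b ∧ c ≡ b
∧-implied {true}  b⇒c = b⇒c refl
∧-implied {false} b⇒c = refl

not≡ᵇ⇒≢ : ∀ m n → not (m ≡ᵇ n) ≡ true → m ≢ n
not≡ᵇ⇒≢ m n h m≡n = subst T (to T-not-≡ (from T-≡ h)) (≡⇒≡ᵇ m n m≡n)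

module _ {n : ℕ} where

  deg-cong : ∀ (G H : Graph n) {v} → (∀ u → adj G v u ≡ adj H v u) → deg G v ≡ deg H v
  deg-cong G H G≗H = countIn-cong G≗H (allFin n)

  module _ (G : Graph n) where

    allNbrs⁺ : ∀ {v p u} → T (allNbrs G v p) → adj G v u ≡ true → T (p u)
    allNbrs⁺ {v} {p} {u} h uv =
      subst (λ b → T (if b then p u else true)) uv (All.lookup (all⁺ _ (allFin n) h) (∈-allFin u))

    allNbrs⁻ : ∀ {v p} → (∀ u → adj G v u ≡ true → T (p u)) → T (allNbrs G v p)
    allNbrs⁻ {v} {p} h =
      all⁻ (λ u → if adj G v u then p u else true) {allFin n} (All.tabulate λ {u} _ → atNbr u)
      where
      atNbr : ∀ u → T (if adj G v u then p u else true)
      atNbr u with adj G v u in uv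
      ... | true  = h u uv
      ... | false = _

    nbrsDegNot2≤deg : ∀ v → nbrsDegNot2 G v ≤ deg G v
    nbrsDegNot2≤deg v = countIn-mono (λ u → ∧-conicalˡ _ _) (allFin n)

    good⇒deg≢2 : ∀ {v} → Good G v → deg G v ≢ 2
    good⇒deg≢2 {v} good d = <-irrefl refl (≤-trans good (≤-trans (nbrsDegNot2≤deg v) (≤-reflexive d)))

    marked⇒deg≡2 : ∀ {v} → Marked G v → deg G v ≡ 2
    marked⇒deg≡2 {v} m = ≡ᵇ⇒≡ (deg G v) 2 (proj₁ (to T-∧ m))

    marked⇒nbrs-good : ∀ {v u} → Marked G v → adj G v u ≡ true → Good G u
    marked⇒nbrs-good {v} {u} m uv = ≤ᵇ⇒≤ 3 _ (allNbrs⁺ (proj₂ (to T-∧ m)) uv)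

    marked⁺ : ∀ {v} → deg G v ≡ 2 → (∀ u → adj G v u ≡ true → Good G u) → Marked G v
    marked⁺ {v} d good = from T-∧ (≡⇒≡ᵇ (deg G v) 2 d , allNbrs⁻ (λ u uv → ≤⇒≤ᵇ (good u uv)))

module Deletion {n : ℕ} (Gpre : Graph n) (σ coin : Fin n → Bool) where

  G : Graph n
  G = result Gpre σ coin

  del : Fin n → Bool
  del = deleted Gpre σ coin

  deleted⇒marked : ∀ {v} → del v ≡ true → Marked Gpre v
  deleted⇒marked dv = from T-≡ (∧-conicalˡ _ _ dv)

  deg≢2⇒undeleted : ∀ {v} → deg Gpre v ≢ 2 → del v ≡ false
  deg≢2⇒undeleted d≢2 = ¬-not (λ dv → d≢2 (marked⇒deg≡2 Gpre (deleted⇒marked dv)))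

  good⇒undeleted : ∀ {v} → Good Gpre v → del v ≡ false
  good⇒undeleted good = deg≢2⇒undeleted (good⇒deg≢2 Gpre good)

  deleted⇒isolated : ∀ {v} → del v ≡ true → deg G v ≡ 0
  deleted⇒isolated {v} dv = countIn-zero noEdge (allFin n)
    where
    noEdge : ∀ u → adj G v u ≡ false
    noEdge u = trans (cong (λ b → adj Gpre v u ∧ (not b ∧ not (del u))) dv) (∧-zeroʳ _)

  edge-survives : ∀ {v u} → del v ≡ false → del u ≡ false → adj G v u ≡ adj Gpre v u
  edge-survives {v} {u} dv du =
    trans (cong₂ (λ b c → adj Gpre v u ∧ (not b ∧ not c)) dv du) (∧-identityʳ _)

  nbhd-preserved : ∀ {v} → del v ≡ false → (∀ {u} → adj Gpre v u ≡ true → del u ≡ false) →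
                   ∀ u → adj G v u ≡ adj Gpre v u
  nbhd-preserved dv nbrs u = ∧-implied λ vu → cong₂ (λ b c → not b ∧ not c) dv (nbrs vu)

  nbrsDegNot2≤deg-result : ∀ {v} → del v ≡ false → nbrsDegNot2 Gpre v ≤ deg G v
  nbrsDegNot2≤deg-result {v} dv = countIn-mono survives (allFin n)
    where
    survives : ∀ u → (adj Gpre v u ∧ not (deg Gpre u ≡ᵇ 2)) ≡ true → adj G v u ≡ true
    survives u h = trans (edge-survives dv (deg≢2⇒undeleted (not≡ᵇ⇒≢ _ 2 (∧-conicalʳ _ _ h))))
                         (∧-conicalˡ _ _ h)

  -- A deleted neighbour u is marked, so v is good; being undeleted, v keeps ≥ 3 edges.
  low-degree⇒nbrs-undeleted : ∀ {v u} → del v ≡ false → deg G v < 3 →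
                              adj Gpre v u ≡ true → del u ≡ false
  low-degree⇒nbrs-undeleted {v} {u} dv d<3 vu = ¬-not λ du →
    <-irrefl refl (≤-trans d<3 (≤-trans (v-good du) (nbrsDegNot2≤deg-result dv)))
    where
    v-good : del u ≡ true → Good Gpre v
    v-good du = marked⇒nbrs-good Gpre (deleted⇒marked du) (trans (Graph.sym Gpre u v) vu)

  deg≡2⇒marked : ∀ {v} → deg G v ≡ 2 → (∀ u → adj G v u ≡ true → Good Gpre u) → Marked Gpre v
  deg≡2⇒marked {v} d good =
    marked⁺ Gpre (trans (sym (deg-cong G Gpre same)) d) (λ u uv → good u (trans (same u) uv))
    where
    v-undeleted : del v ≡ false
    v-undeleted = ¬-not λ dv → contradiction (trans (sym (deleted⇒isolated dv)) d) λ ()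
    same : ∀ u → adj G v u ≡ adj Gpre v u
    same = nbhd-preserved v-undeleted
             (low-degree⇒nbrs-undeleted v-undeleted (≤-reflexive (cong ℕ.suc d)))

  marked⇒deg≡2⊎isolated : ∀ {v} → Marked Gpre v →
    (deg G v ≡ 2 × (∀ u → adj G v u ≡ true → Good Gpre u)) ⊎ deg G v ≡ 0
  marked⇒deg≡2⊎isolated {v} m with del v ≟ true
  ... | yes dv = inj₂ (deleted⇒isolated dv)
  ... | no ¬dv = inj₁ (trans (deg-cong G Gpre same) (marked⇒deg≡2 Gpre m) ,
                      λ u uv → marked⇒nbrs-good Gpre m (trans (sym (same u)) uv))
    where
    same : ∀ u → adj G v u ≡ adj Gpre v u
    same = nbhd-preserved (¬-not ¬dv) (λ uv → good⇒undeleted (marked⇒nbrs-good Gpre m uv))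

lemma5p6 : (n : ℕ) (Gpre : Graph n) (σ coin : Fin n → Bool) (v : Fin n) →
    ((deg (result Gpre σ coin) v ≡ 2 ×
        (∀ u → adj (result Gpre σ coin) v u ≡ true → Good Gpre u))
      → Marked Gpre v)
    × (Marked Gpre v →
        (deg (result Gpre σ coin) v ≡ 2 ×
          (∀ u → adj (result Gpre σ coin) v u ≡ true → Good Gpre u))
        ⊎ deg (result Gpre σ coin) v ≡ 0)
lemma5p6 n Gpre σ coin v = (λ (d , good) → deg≡2⇒marked d good) , marked⇒deg≡2⊎isolated
  where open Deletion Gpre σ coin
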